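{- Let $T_\sigma=(V_\sigma,A)$ be a tournament with a fixed vertex ordering $\sigma$, let $k$ be a nonnegative integer, and let $\mathcal{P}=\{V_1,\dots,V_l\}$ be a safe partition of $V_\sigma$ into intervals. Let $F$ be the set of backward arcs of $T_\sigma[A_B]$, and let $T'$ be the tournament obtained from $T_\sigma$ by reversing all arcs of $F$. Then $T_\sigma$ has a feedback arc set of size at most $k$ if and only if $T'$ has a feedback arc set of size at most $k-|F|$.
   Context: For an ordering $\sigma=v_1,\dots,v_n$, an arc $v_iv_j$ is backward if $i>j$ and forward otherwise; the span of $v_iv_j$ is $\{v_{\min(i,j)},\dots,v_{\max(i,j)}\}$. For a partition of $V_\sigma$ into intervals, $A_B$ is the set of arcs whose endpoints lie in different intervals, and $T_\sigma[A_B]$ is the digraph with arc set $A_B$ on the endpoints of these arcs. For a backward arc $f=vu$, a certificate of $f$ is a directed path from $u$ to $v$ using only forward arcs within the span of $f$. The partition is safe if there is a family of pairwise arc-disjoint certificates, one for each backward arc of $T_\sigma[A_B]$, all using only arcs of $A_B$. A feedback arc set is a set of arcs whose removal makes the digraph acyclic. -}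

module Defs where

open import Data.Nat using (ℕ; _+_) renaming (_≤_ to _≤ℕ_)
open import Data.Fin using (Fin; _<_; _≤_)
open import Data.Fin.Properties using (_≟_; _<?_)
open import Data.Bool using (Bool; true; false; T; _∧_; not; _xor_; _∨_)
open import Data.List using (List; []; _∷_; length; filterᵇ; cartesianProduct; allFin)
open import Data.List.Membership.Propositional using (_∈_; _∉_)
open import Data.List.Relation.Unary.All using (All)
open import Data.List.Relation.Unary.Unique.Propositional using (Unique)
open import Data.Product using (Σ; _×_; _,_; proj₁; proj₂; ∃)
open import Data.Empty using (⊥)
open import Relation.Nullary using (¬_)
open import Relation.Nullary.Decidable using (⌊_⌋)
open import Relation.Binary.PropositionalEquality using (_≡_; _≢_)
open import Relation.Binary.Construct.Closure.Transitive using (TransClosure)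

-- A digraph on the ordered vertex set V_σ = Fin n (vertex i is the i-th
-- vertex of σ); arc i j ≡ true means there is an arc from i to j.
Digraph : ℕ → Set
Digraph n = Fin n → Fin n → Bool

record IsTournament {n : ℕ} (arc : Digraph n) : Set where
  field
    irrefl : ∀ i → arc i i ≡ false
    total  : ∀ i j → i ≢ j → T (arc i j ∨ arc j i)
    asym   : ∀ i j → T (arc i j) → arc j i ≡ false

-- Partition of V_σ into l intervals V_1..V_l: a monotone surjective map
-- assigning to each vertex the index of its interval.
record IntervalPartition (n l : ℕ) : Set where
  field
    part     : Fin n → Fin l
    monotone : ∀ i j → i ≤ j → part i ≤ part j
    onto     : ∀ b → ∃ λ i → part i ≡ b

open IntervalPartition public

module _ {n l : ℕ} (arc : Digraph n) (P : IntervalPartition n l) where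

  inAB : Fin n → Fin n → Bool
  inAB i j = arc i j ∧ not ⌊ part P i ≟ part P j ⌋

  backwardAB : Fin n → Fin n → Bool
  backwardAB i j = inAB i j ∧ ⌊ j <? i ⌋

  forwardAB : Fin n → Fin n → Set
  forwardAB i j = T (inAB i j ∧ ⌊ i <? j ⌋)

  Fset : List (Fin n × Fin n)
  Fset = filterᵇ (λ e → backwardAB (proj₁ e) (proj₂ e))
                 (cartesianProduct (allFin n) (allFin n))

  sizeF : ℕ
  sizeF = length Fset

data Walk {n : ℕ} (R : Fin n → Fin n → Set) : Fin n → Fin n → Set where
  []  : ∀ {x} → Walk R x x
  _∷_ : ∀ {x y z} → R x y → Walk R y z → Walk R x z

arcsOf : ∀ {n} {R : Fin n → Fin n → Set} {x y} → Walk R x y → List (Fin n × Fin n)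
arcsOf [] = []
arcsOf (_∷_ {x} {y} _ w) = (x , y) ∷ arcsOf w

-- A certificate for the backward arc v→u: a directed path from u to v using
-- only forward arcs (here: forward arcs of A_B) within the span of v→u.
-- (A walk along forward arcs is strictly increasing, hence a path.)
record Certificate {n l : ℕ} (arc : Digraph n) (P : IntervalPartition n l)
                   (v u : Fin n) : Set where
  field
    walk   : Walk (forwardAB arc P) u v
    inSpan : All (λ e → (u ≤ proj₁ e × proj₁ e ≤ v) × (u ≤ proj₂ e × proj₂ e ≤ v))
                 (arcsOf walk)

open Certificate public

Safe : ∀ {n l} → Digraph n → IntervalPartition n l → Set
Safe {n} arc P =
  Σ ((v u : Fin n) → T (backwardAB arc P v u) → Certificate arc P v u) λ cert →
    ∀ v u v' u' (b : T (backwardAB arc P v u)) (b' : T (backwardAB arc P v' u')) →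
      (v , u) ≢ (v' , u') →
      ∀ e → e ∈ arcsOf (walk (cert v u b)) → e ∈ arcsOf (walk (cert v' u' b')) → ⊥

reverseF : ∀ {n l} → Digraph n → IntervalPartition n l → Digraph n
reverseF arc P i j = arc i j xor (backwardAB arc P i j ∨ backwardAB arc P j i)

Acyclic : ∀ {n} → (Fin n → Fin n → Set) → Set
Acyclic {n} R = ∀ (x : Fin n) → ¬ TransClosure R x x

IsFAS : ∀ {n} → Digraph n → List (Fin n × Fin n) → Set
IsFAS {n} arc S =
  Unique S × All (λ e → T (arc (proj₁ e) (proj₂ e))) S ×
  Acyclic (λ x y → T (arc x y) × (x , y) ∉ S)

HasFASAtMost : ∀ {n} → Digraph n → ℕ → Set
HasFASAtMost {n} arc m = Σ (List (Fin n × Fin n)) λ S → IsFAS arc S × length S ≤ℕ m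

-- the digraph has a FAS S with |S| ≤ k - f  (integer reading: |S| + f ≤ k)
HasFASAtMostMinus : ∀ {n} → Digraph n → ℕ → ℕ → Set
HasFASAtMostMinus {n} arc k f =
  Σ (List (Fin n × Fin n)) λ S → IsFAS arc S × length S + f ≤ℕ k

module Submission where

-- (⇒) Let S be a feedback arc set of T_σ, split into the arcs S_W inside an
--   interval and the arcs S_B between intervals.  Every f ∈ F closes a cycle
--   with its certificate, so S meets that cycle; the certificates are
--   arc-disjoint and consist of forward arcs, so this assigns distinct arcs
--   of S_B to distinct arcs of F, whence |F| ≤ |S_B|.  In T' every arc between
--   two intervals goes to a later interval, so a cycle of T' − S_W stays in a
--   single interval, where T' = T_σ; hence S_W is a feedback arc set of T'
--   and |S_W| + |F| ≤ |S| ≤ k.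
-- (⇐) If S' is a feedback arc set of T', then F ∪ (S' ∩ A) is one of T_σ:
--   an arc of T_σ outside F is an arc of T' (T_σ is a tournament).

open import Defs
open import Data.Nat using (ℕ; suc; z≤n; s≤s; _+_) renaming (_≤_ to _≤ℕ_; _<_ to _<ℕ_)
import Data.Nat.Properties as ℕP
open import Data.Fin using (Fin; toℕ; _<_)
import Data.Fin.Properties as FinP
open import Data.Bool using (true; false; T; not; _∧_; _∨_; _xor_)
open import Data.Bool.Properties using (T-∧; T-≡; ∧-zeroʳ; ∧-identityʳ; ∨-identityʳ; xor-same; xor-comm)
open import Data.List using (List; []; _∷_; length; filter; cartesianProduct; allFin; _++_)
import Data.List.Properties as ListP
open import Data.List.Membership.Propositional using (_∈_; _∉_; find)
open import Data.List.Membership.Propositional.Properties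
  using (∈-filter⁺; ∈-filter⁻; ∈-cartesianProduct⁺; ∈-allFin; ∈-++⁻; ∈-++⁺ˡ; ∈-++⁺ʳ)
import Data.List.Membership.DecPropositional as DecMembership
open import Data.List.Relation.Unary.Any using (here; there; any?; _─_)
open import Data.List.Relation.Unary.All as All using (All; []; _∷_)
open import Data.List.Relation.Unary.All.Properties using (¬Any⇒All¬)
open import Data.List.Relation.Unary.AllPairs using (_∷_)
open import Data.List.Relation.Unary.Unique.Propositional using (Unique)
import Data.List.Relation.Unary.Unique.Propositional.Properties as UniqueP
open import Data.Product using (∃; _×_; _,_; proj₁; proj₂)
open import Data.Product.Properties using (≡-dec)
open import Data.Sum using (_⊎_; inj₁; inj₂)
open import Data.Empty using (⊥; ⊥-elim)
open import Function.Bundles using (_⇔_; mk⇔; Equivalence)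
open import Relation.Nullary using (¬_; Dec; yes; no; ¬?)
open import Relation.Nullary.Decidable using (⌊_⌋; isYes≗does; dec-true; dec-false; toWitness; toWitnessFalse)
open import Relation.Nullary.Decidable.Core using (T?)
open import Relation.Unary using (Decidable)
open import Relation.Binary.Definitions using (DecidableEquality; tri<; tri≈; tri>)
open import Relation.Binary.PropositionalEquality
  using (_≡_; _≢_; refl; sym; trans; cong; cong₂; subst; module ≡-Reasoning)
open import Relation.Binary.Construct.Closure.Transitive using (TransClosure; [_]; _∷_)

open Equivalence using (to)

⌊⌋-yes : ∀ {A : Set} (d : Dec A) → A → ⌊ d ⌋ ≡ true
⌊⌋-yes d a = trans (isYes≗does d) (dec-true d a)

⌊⌋-no : ∀ {A : Set} (d : Dec A) → ¬ A → ⌊ d ⌋ ≡ false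
⌊⌋-no d ¬a = trans (isYes≗does d) (dec-false d ¬a)

∈-─ : ∀ {A : Set} {x z : A} {ys : List A} (x∈ys : x ∈ ys) →
      z ∈ ys → z ≢ x → z ∈ (ys ─ x∈ys)
∈-─ (here refl) (here refl) z≢x = ⊥-elim (z≢x refl)
∈-─ (here refl) (there z∈ys) _  = z∈ys
∈-─ (there _)   (here refl)  _  = here refl
∈-─ (there x∈ys) (there z∈ys) z≢x = there (∈-─ x∈ys z∈ys z≢x)

injection⇒length≤ : ∀ {A B : Set} (xs : List A) (ys : List B) → Unique xs →
  (h : ∀ {x} → x ∈ xs → B) →
  (∀ {x y} (p : x ∈ xs) (q : y ∈ xs) → h p ≡ h q → x ≡ y) →
  (∀ {x} (p : x ∈ xs) → h p ∈ ys) →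
  length xs ≤ℕ length ys
injection⇒length≤ [] ys _ h inj mem = z≤n
injection⇒length≤ (x ∷ xs) ys (x∉xs ∷ unique) h inj mem = begin
  suc (length xs)          ≤⟨ s≤s (injection⇒length≤ xs (ys ─ hx∈ys) unique
                                     (λ p → h (there p))
                                     (λ p q → inj (there p) (there q))
                                     hxs∈rest) ⟩
  suc (length (ys ─ hx∈ys)) ≡⟨ sym (ListP.length-removeAt′ ys _) ⟩
  length ys                ∎
  where
  open ℕP.≤-Reasoning
  hx∈ys = mem (here refl)
  hxs∈rest : ∀ {y} (p : y ∈ xs) → h (there p) ∈ (ys ─ hx∈ys)
  hxs∈rest p = ∈-─ hx∈ys (mem (there p))
                 (λ eq → All.lookup x∉xs p (inj (here refl) (there p) (sym eq)))

length-filter-split : ∀ {A : Set} {P : A → Set} (P? : Decidable P) (xs : List A) →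
  length (filter P? xs) + length (filter (λ x → ¬? (P? x)) xs) ≡ length xs
length-filter-split P? [] = refl
length-filter-split P? (x ∷ xs) with P? x
... | yes _ = cong suc (length-filter-split P? xs)
... | no _  = trans (ℕP.+-suc _ _) (cong suc (length-filter-split P? xs))

Arc : ℕ → Set
Arc n = Fin n × Fin n

_≟ᴬ_ : ∀ {n} → DecidableEquality (Arc n)
_≟ᴬ_ = ≡-dec FinP._≟_ FinP._≟_

Without : ∀ {n} → Digraph n → List (Arc n) → Fin n → Fin n → Set
Without arc S x y = T (arc x y) × (x , y) ∉ S

walk-arcs : ∀ {n} {R : Fin n → Fin n → Set} {x y} (w : Walk R x y) →
            ∀ {e} → e ∈ arcsOf w → R (proj₁ e) (proj₂ e)
walk-arcs (r ∷ w) (here refl) = r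
walk-arcs (r ∷ w) (there e∈w) = walk-arcs w e∈w

cons-walk : ∀ {n} {R : Fin n → Fin n → Set} {x y z} →
            R x y → Walk R y z → TransClosure R x z
cons-walk r []       = [ r ]
cons-walk r (r′ ∷ w) = r ∷ cons-walk r′ w

avoiding-walk : ∀ {n} {arc : Digraph n} {S : List (Arc n)} {R : Fin n → Fin n → Set} →
  (∀ {x y} → R x y → T (arc x y)) →
  ∀ {x y} (w : Walk R x y) → All (_∉ S) (arcsOf w) → Walk (Without arc S) x y
avoiding-walk R⊆arc []      []            = []
avoiding-walk R⊆arc (r ∷ w) (r∉S ∷ w∉S) = (R⊆arc r , r∉S) ∷ avoiding-walk R⊆arc w w∉S

fas-meets-cycle : ∀ {n} {arc : Digraph n} {S : List (Arc n)} {R : Fin n → Fin n → Set} →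
  Acyclic (Without arc S) → (∀ {x y} → R x y → T (arc x y)) →
  ∀ {u v} → T (arc v u) → (w : Walk R u v) →
  ∃ λ d → d ∈ (v , u) ∷ arcsOf w × d ∈ S
fas-meets-cycle {S = S} acyclic R⊆arc {u} {v} vu w
  with any? (λ e → DecMembership._∈?_ _≟ᴬ_ e S) ((v , u) ∷ arcsOf w)
... | yes hit = find hit
... | no miss with ¬Any⇒All¬ _ miss
...   | vu∉S ∷ w∉S = ⊥-elim (acyclic v (cons-walk (vu , vu∉S) (avoiding-walk R⊆arc w w∉S)))

acyclic-sub : ∀ {n} {R Q : Fin n → Fin n → Set} → (∀ {x y} → R x y → Q x y) →
              Acyclic Q → Acyclic R
acyclic-sub {R = R} {Q} R⊆Q acyclic x c = acyclic x (closure c)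
  where
  closure : ∀ {x y} → TransClosure R x y → TransClosure Q x y
  closure [ r ]   = [ R⊆Q r ]
  closure (r ∷ c) = R⊆Q r ∷ closure c

-- If every R-step either stays on its level of ρ as a Q-step or strictly
-- climbs, then a closed R-walk never climbs and is therefore a closed Q-walk.
module Levelled {A : Set} {R Q : A → A → Set} (ρ : A → ℕ)
    (step : ∀ {x y} → R x y → (ρ x ≡ ρ y × Q x y) ⊎ ρ x <ℕ ρ y) where

  step-≤ : ∀ {x y} → R x y → ρ x ≤ℕ ρ y
  step-≤ r with step r
  ... | inj₁ (same , _) = ℕP.≤-reflexive same
  ... | inj₂ climbs     = ℕP.<⇒≤ climbs

  ascending : ∀ {x y} → TransClosure R x y → ρ x ≤ℕ ρ y
  ascending [ r ]   = step-≤ r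
  ascending (r ∷ c) = ℕP.≤-trans (step-≤ r) (ascending c)

  flat : ∀ {x y} → TransClosure R x y → ρ y ≤ℕ ρ x → TransClosure Q x y
  flat [ r ] y≤x with step r
  ... | inj₁ (_ , q)    = [ q ]
  ... | inj₂ climbs     = ⊥-elim (ℕP.<⇒≱ climbs y≤x)
  flat (r ∷ c) z≤x with step r
  ... | inj₁ (same , q) = q ∷ flat c (ℕP.≤-trans z≤x (ℕP.≤-reflexive same))
  ... | inj₂ climbs     = ⊥-elim (ℕP.<⇒≱ climbs (ℕP.≤-trans (ascending c) z≤x))

  closed-walk : ∀ {x} → TransClosure R x x → TransClosure Q x x
  closed-walk c = flat c ℕP.≤-refl

module _ {n l : ℕ} (arc : Digraph n) (P : IntervalPartition n l) where

  Within : Fin n → Fin n → Set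
  Within i j = part P i ≡ part P j

  within? : Decidable (λ (e : Arc n) → Within (proj₁ e) (proj₂ e))
  within? (i , j) = part P i FinP.≟ part P j

  level : Fin n → ℕ
  level i = toℕ (part P i)

  inAB⇒ : ∀ {i j} → T (inAB arc P i j) → T (arc i j) × ¬ Within i j
  inAB⇒ {i} {j} t with to T-∧ t
  ... | ij , crossing = ij , toWitnessFalse {a? = part P i FinP.≟ part P j} crossing

  forwardAB⇒ : ∀ {i j} → forwardAB arc P i j → (T (arc i j) × ¬ Within i j) × i < j
  forwardAB⇒ t with to T-∧ t
  ... | ab , i<j = inAB⇒ ab , toWitness i<j

  backwardAB⇒ : ∀ {i j} → T (backwardAB arc P i j) → (T (arc i j) × ¬ Within i j) × j < i
  backwardAB⇒ t with to T-∧ t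
  ... | ab , j<i = inAB⇒ ab , toWitness j<i

  backwardAB-within : ∀ {i j} → Within i j → backwardAB arc P i j ≡ false
  backwardAB-within {i} {j} w = begin
    (arc i j ∧ not (⌊ part P i FinP.≟ part P j ⌋)) ∧ ⌊ j FinP.<? i ⌋
      ≡⟨ cong (λ b → (arc i j ∧ not b) ∧ ⌊ j FinP.<? i ⌋) (⌊⌋-yes (part P i FinP.≟ part P j) w) ⟩
    (arc i j ∧ false) ∧ ⌊ j FinP.<? i ⌋
      ≡⟨ cong (_∧ ⌊ j FinP.<? i ⌋) (∧-zeroʳ (arc i j)) ⟩
    false ∎
    where open ≡-Reasoning

  backwardAB-ascending : ∀ {i j} → ¬ j < i → backwardAB arc P i j ≡ false
  backwardAB-ascending {i} {j} j≮i = begin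
    inAB arc P i j ∧ ⌊ j FinP.<? i ⌋ ≡⟨ cong (inAB arc P i j ∧_) (⌊⌋-no (j FinP.<? i) j≮i) ⟩
    inAB arc P i j ∧ false             ≡⟨ ∧-zeroʳ _ ⟩
    false ∎
    where open ≡-Reasoning

  backwardAB-descending : ∀ {i j} → ¬ Within i j → j < i → backwardAB arc P i j ≡ arc i j
  backwardAB-descending {i} {j} crossing j<i = begin
    (arc i j ∧ not (⌊ part P i FinP.≟ part P j ⌋)) ∧ ⌊ j FinP.<? i ⌋
      ≡⟨ cong₂ (λ b c → (arc i j ∧ not b) ∧ c)
               (⌊⌋-no (part P i FinP.≟ part P j) crossing) (⌊⌋-yes (j FinP.<? i) j<i) ⟩
    (arc i j ∧ true) ∧ true ≡⟨ ∧-identityʳ _ ⟩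
    arc i j ∧ true          ≡⟨ ∧-identityʳ _ ⟩
    arc i j ∎
    where open ≡-Reasoning

  reverseF-outsideF : ∀ {i j} → backwardAB arc P i j ≡ false → backwardAB arc P j i ≡ false →
                      reverseF arc P i j ≡ arc i j
  reverseF-outsideF {i} {j} ij∉F ji∉F = begin
    arc i j xor (backwardAB arc P i j ∨ backwardAB arc P j i)
      ≡⟨ cong₂ (λ b c → arc i j xor (b ∨ c)) ij∉F ji∉F ⟩
    arc i j xor false ≡⟨ xor-comm (arc i j) false ⟩
    arc i j ∎
    where open ≡-Reasoning

  reverseF-within : ∀ {i j} → Within i j → reverseF arc P i j ≡ arc i j
  reverseF-within w = reverseF-outsideF (backwardAB-within w) (backwardAB-within (sym w))

  reverseF-F : ∀ {i j} → T (backwardAB arc P i j) → reverseF arc P i j ≡ false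
  reverseF-F {i} {j} ij∈F = begin
    arc i j xor (backwardAB arc P i j ∨ backwardAB arc P j i)
      ≡⟨ cong₂ (λ a b → a xor (b ∨ backwardAB arc P j i))
               (to T-≡ (proj₁ (proj₁ (backwardAB⇒ ij∈F)))) (to T-≡ ij∈F) ⟩
    true xor true ≡⟨⟩
    false ∎
    where open ≡-Reasoning

  reverseF-descending : ∀ {i j} → ¬ Within i j → j < i → reverseF arc P i j ≡ false
  reverseF-descending {i} {j} crossing j<i = begin
    arc i j xor (backwardAB arc P i j ∨ backwardAB arc P j i)
      ≡⟨ cong₂ (λ b c → arc i j xor (b ∨ c))
               (backwardAB-descending crossing j<i) (backwardAB-ascending (FinP.<-asym j<i)) ⟩
    arc i j xor (arc i j ∨ false) ≡⟨ cong (arc i j xor_) (∨-identityʳ (arc i j)) ⟩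
    arc i j xor arc i j           ≡⟨ xor-same (arc i j) ⟩
    false ∎
    where open ≡-Reasoning

  reverseF-climbs : ∀ {i j} → T (reverseF arc P i j) → ¬ Within i j → level i <ℕ level j
  reverseF-climbs {i} {j} ij crossing with FinP.<-cmp i j
  ... | tri< i<j _ _ = FinP.≤∧≢⇒< (monotone P i j (ℕP.<⇒≤ i<j)) crossing
  ... | tri≈ _ refl _ = ⊥-elim (crossing refl)
  ... | tri> _ _ j<i = ⊥-elim (subst T (reverseF-descending crossing j<i) ij)

  reverseF-keeps : IsTournament arc → ∀ {i j} → T (arc i j) → ¬ T (backwardAB arc P i j) →
                   T (reverseF arc P i j)
  reverseF-keeps tournament {i} {j} ij ij∉F =
    subst T (sym (reverseF-outsideF (dec-false (T? _) ij∉F) ji∉F)) ij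
    where
    -- j→i is not even an arc of T_σ
    ji∉F : backwardAB arc P j i ≡ false
    ji∉F = cong (λ a → (a ∧ _) ∧ _) (IsTournament.asym tournament i j ij)

  Fset-unique : Unique (Fset arc P)
  Fset-unique = UniqueP.filter⁺ _ (UniqueP.cartesianProduct⁺ (UniqueP.allFin⁺ n) (UniqueP.allFin⁺ n))

  ∈Fset⁺ : ∀ {i j} → T (backwardAB arc P i j) → (i , j) ∈ Fset arc P
  ∈Fset⁺ {i} {j} = ∈-filter⁺ _ (∈-cartesianProduct⁺ (∈-allFin i) (∈-allFin j))

  ∈Fset⁻ : ∀ {e} → e ∈ Fset arc P → T (backwardAB arc P (proj₁ e) (proj₂ e))
  ∈Fset⁻ e∈F = proj₂ (∈-filter⁻ _ {xs = cartesianProduct (allFin n) (allFin n)} e∈F)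

module FromFASofT {n l : ℕ} (arc : Digraph n) (P : IntervalPartition n l) (safe : Safe arc P)
                  (S : List (Arc n)) (fas : IsFAS arc S) where

  certificate : (v u : Fin n) → T (backwardAB arc P v u) → Certificate arc P v u
  certificate = proj₁ safe

  cycle : (v u : Fin n) → T (backwardAB arc P v u) → List (Arc n)
  cycle v u vu = (v , u) ∷ arcsOf (walk (certificate v u vu))

  S-within S-between : List (Arc n)
  S-within  = filter (within? arc P) S
  S-between = filter (λ e → ¬? (within? arc P e)) S

  -- an arc of F never lies on a certificate, whose arcs all ascend in σ
  F∉certificate : ∀ {v u} → T (backwardAB arc P v u) →
                  ∀ {x y} (w : Walk (forwardAB arc P) x y) → (v , u) ∉ arcsOf w
  F∉certificate vu w vu∈w =
    FinP.<-asym (proj₂ (backwardAB⇒ arc P vu)) (proj₂ (forwardAB⇒ arc P (walk-arcs w vu∈w)))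

  cycles-disjoint : ∀ {v u v′ u′} (vu : T (backwardAB arc P v u)) (vu′ : T (backwardAB arc P v′ u′)) →
                    (v , u) ≢ (v′ , u′) →
                    ∀ {d} → d ∈ cycle v u vu → d ∈ cycle v′ u′ vu′ → ⊥
  cycles-disjoint _  _   ne (here refl) (here refl) = ne refl
  cycles-disjoint vu _   _  (here refl) (there d∈w′) = F∉certificate vu _ d∈w′
  cycles-disjoint _  vu′ _  (there d∈w) (here refl)  = F∉certificate vu′ _ d∈w
  cycles-disjoint {v} {u} {v′} {u′} vu vu′ ne (there d∈w) (there d∈w′) =
    proj₂ safe v u v′ u′ vu vu′ ne _ d∈w d∈w′

  breaker : ∀ {e} (e∈F : e ∈ Fset arc P) → ∃ λ d → d ∈ cycle (proj₁ e) (proj₂ e) (∈Fset⁻ arc P e∈F) × d ∈ S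
  breaker e∈F = fas-meets-cycle (proj₂ (proj₂ fas)) (λ f → proj₁ (proj₁ (forwardAB⇒ arc P f)))
                  (proj₁ (proj₁ (backwardAB⇒ arc P (∈Fset⁻ arc P e∈F)))) _

  breaker-between : ∀ {e} (e∈F : e ∈ Fset arc P) → proj₁ (breaker e∈F) ∈ S-between
  breaker-between e∈F with breaker e∈F
  ... | d , d∈cycle , d∈S = ∈-filter⁺ _ d∈S (crossing d∈cycle)
    where
    crossing : ∀ {d} → d ∈ cycle _ _ (∈Fset⁻ arc P e∈F) → ¬ Within arc P (proj₁ d) (proj₂ d)
    crossing (here refl)  = proj₂ (proj₁ (backwardAB⇒ arc P (∈Fset⁻ arc P e∈F)))
    crossing (there d∈w)  = proj₂ (proj₁ (forwardAB⇒ arc P (walk-arcs _ d∈w)))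

  -- distinct arcs of F have distinct breakers, their cycles being disjoint
  breaker-injective : ∀ {e e′} (e∈F : e ∈ Fset arc P) (e′∈F : e′ ∈ Fset arc P) →
                      proj₁ (breaker e∈F) ≡ proj₁ (breaker e′∈F) → e ≡ e′
  breaker-injective {e} {e′} e∈F e′∈F same with e ≟ᴬ e′
  ... | yes e≡e′ = e≡e′
  ... | no  e≢e′ = ⊥-elim (cycles-disjoint (∈Fset⁻ arc P e∈F) (∈Fset⁻ arc P e′∈F) e≢e′
                            (proj₁ (proj₂ (breaker e∈F)))
                            (subst (_∈ cycle _ _ (∈Fset⁻ arc P e′∈F)) (sym same)
                                   (proj₁ (proj₂ (breaker e′∈F)))))

  |F|≤|S-between| : sizeF arc P ≤ℕ length S-between
  |F|≤|S-between| = injection⇒length≤ (Fset arc P) S-between (Fset-unique arc P)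
                      (λ e∈F → proj₁ (breaker e∈F)) breaker-injective breaker-between

  step : ∀ {x y} → Without (reverseF arc P) S-within x y →
         (level arc P x ≡ level arc P y × Without arc S x y) ⊎ level arc P x <ℕ level arc P y
  step {x} {y} (xy , xy∉S-within) = by-interval (within? arc P (x , y))
    where
    by-interval : Dec (Within arc P x y) →
      (level arc P x ≡ level arc P y × Without arc S x y) ⊎ level arc P x <ℕ level arc P y
    by-interval (yes w)  = inj₁ (cong toℕ w , subst T (reverseF-within arc P w) xy ,
                                 λ xy∈S → xy∉S-within (∈-filter⁺ _ xy∈S w))
    by-interval (no  nw) = inj₂ (reverseF-climbs arc P xy nw)

  -- S_W is a feedback arc set of T': its arcs are arcs of T' and a cycle of
  -- T' − S_W would be a cycle of T_σ − S
  S-within-FAS : IsFAS (reverseF arc P) S-within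
  S-within-FAS = UniqueP.filter⁺ _ (proj₁ fas) , arcs , acyclic
    where
    arcs : All (λ e → T (reverseF arc P (proj₁ e) (proj₂ e))) S-within
    arcs = All.tabulate λ e∈S-within →
      let (e∈S , w) = ∈-filter⁻ (within? arc P) {xs = S} e∈S-within
      in subst T (sym (reverseF-within arc P w)) (All.lookup (proj₁ (proj₂ fas)) e∈S)
    acyclic : Acyclic (Without (reverseF arc P) S-within)
    acyclic x c = proj₂ (proj₂ fas) x (Levelled.closed-walk (level arc P) step c)

  size : ∀ {k} → length S ≤ℕ k → length S-within + sizeF arc P ≤ℕ k
  size {k} |S|≤k = begin
    length S-within + sizeF arc P         ≤⟨ ℕP.+-monoʳ-≤ (length S-within) |F|≤|S-between| ⟩
    length S-within + length S-between    ≡⟨ length-filter-split (within? arc P) S ⟩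
    length S                              ≤⟨ |S|≤k ⟩
    k ∎
    where open ℕP.≤-Reasoning

module FromFASofT′ {n l : ℕ} (arc : Digraph n) (P : IntervalPartition n l)
                   (tournament : IsTournament arc)
                   (S′ : List (Arc n)) (fas′ : IsFAS (reverseF arc P) S′) where

  isArc? : Decidable (λ (e : Arc n) → T (arc (proj₁ e) (proj₂ e)))
  isArc? e = T? (arc (proj₁ e) (proj₂ e))

  S′-arcs S : List (Arc n)
  S′-arcs = filter isArc? S′
  S       = Fset arc P ++ S′-arcs

  -- no arc of F is an arc of T', so F and S' are disjoint
  F∉S′ : ∀ {e} → ¬ (e ∈ Fset arc P × e ∈ S′-arcs)
  F∉S′ (e∈F , e∈S′-arcs) =
    subst T (reverseF-F arc P (∈Fset⁻ arc P e∈F))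
          (All.lookup (proj₁ (proj₂ fas′)) (proj₁ (∈-filter⁻ isArc? {xs = S′} e∈S′-arcs)))

  S-arcs : All (λ e → T (arc (proj₁ e) (proj₂ e))) S
  S-arcs = All.tabulate λ e∈S → arcOf (∈-++⁻ (Fset arc P) e∈S)
    where
    arcOf : ∀ {e} → e ∈ Fset arc P ⊎ e ∈ S′-arcs → T (arc (proj₁ e) (proj₂ e))
    arcOf (inj₁ e∈F)       = proj₁ (proj₁ (backwardAB⇒ arc P (∈Fset⁻ arc P e∈F)))
    arcOf (inj₂ e∈S′-arcs) = proj₂ (∈-filter⁻ isArc? {xs = S′} e∈S′-arcs)

  step : ∀ {x y} → Without arc S x y → Without (reverseF arc P) S′ x y
  step (xy , xy∉S) =
    reverseF-keeps arc P tournament xy (λ xy∈F → xy∉S (∈-++⁺ˡ (∈Fset⁺ arc P xy∈F))) ,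
    λ xy∈S′ → xy∉S (∈-++⁺ʳ (Fset arc P) (∈-filter⁺ isArc? xy∈S′ xy))

  S-FAS : IsFAS arc S
  S-FAS = UniqueP.++⁺ (Fset-unique arc P) (UniqueP.filter⁺ isArc? (proj₁ fas′)) F∉S′ ,
          S-arcs ,
          acyclic-sub step (proj₂ (proj₂ fas′))

  size : ∀ {k} → length S′ + sizeF arc P ≤ℕ k → length S ≤ℕ k
  size {k} le = begin
    length (Fset arc P ++ S′-arcs)   ≡⟨ ListP.length-++ (Fset arc P) ⟩
    sizeF arc P + length S′-arcs     ≤⟨ ℕP.+-monoʳ-≤ (sizeF arc P) (ListP.length-filter isArc? S′) ⟩
    sizeF arc P + length S′          ≡⟨ ℕP.+-comm (sizeF arc P) (length S′) ⟩
    length S′ + sizeF arc P          ≤⟨ le ⟩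
    k ∎
    where open ℕP.≤-Reasoning

lemma4 : (n l : ℕ) (arc : Digraph n) → IsTournament arc →
         (k : ℕ) (P : IntervalPartition n l) → Safe arc P →
         HasFASAtMost arc k ⇔ HasFASAtMostMinus (reverseF arc P) k (sizeF arc P)
lemma4 n l arc tournament k P safe = mk⇔ toT′ toT
  where
  toT′ : HasFASAtMost arc k → HasFASAtMostMinus (reverseF arc P) k (sizeF arc P)
  toT′ (S , fas , |S|≤k) = S-within , S-within-FAS , size |S|≤k
    where open FromFASofT arc P safe S fas

  toT : HasFASAtMostMinus (reverseF arc P) k (sizeF arc P) → HasFASAtMost arc k
  toT (S′ , fas′ , |S′|+|F|≤k) = S , S-FAS , size |S′|+|F|≤k
    where open FromFASofT′ arc P tournament S′ fas′
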